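{- The set function $S\mapsto\operatorname{fp}(G^S,\delta)$ is not submodular in general: there exist a population structure $G=(V,E,w)$ and $\delta\ge0$ such that the map $2^V\to[0,1]$, $S\mapsto \operatorname{fp}(G^S,\delta)$, is not submodular.
   Context: A population structure is a directed weighted graph $G=(V,E,w)$ on $n$ nodes with $\sum_{(u,v)\in E}w(u,v)=1$ for all $u$ and strongly connected support. Positional Moran process: fix an active set $S\subseteq V$ and $\delta\ge0$. For mutant set $X\subseteq V$, fitness of $u$ is $f_{X,S}(u)=1+\delta$ if $u\in X\cap S$ and $1$ otherwise; $F_S(X)=\sum_u f_{X,S}(u)$. Given $X_t$, a node $u$ is selected with probability $f_{X_t,S}(u)/F_S(X_t)$, then $v$ with probability $w(u,v)$, and $v$ takes the type of $u$: $X_{t+1}=X_t\cup\{v\}$ if $u\in X_t$, else $X_t\setminus\{v\}$. $\operatorname{fp}(G^S,\delta,A)=\mathbb{P}[\exists\tau\ge0:X_\tau=V\mid X_0=A]$ and $\operatorname{fp}(G^S,\delta)=\frac1n\sum_{u\in V}\operatorname{fp}(G^S,\delta,\{u\})$. A set function $p$ on $2^V$ is submodular if $p(S)+p(T)\ge p(S\cup T)+p(S\cap T)$ for all $S,T\subseteq V$. -}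

module Defs where

open import Data.Nat using (ℕ; zero; suc)
open import Data.Fin using (Fin) renaming (zero to fz; suc to fs)
open import Data.Fin.Subset using (Subset; ⁅_⁆; _∪_; _∩_)
open import Data.Bool using (Bool; true; false; if_then_else_; _∧_)
open import Data.Vec using (Vec; []; _∷_; lookup; _[_]≔_)
open import Data.Rational using (ℚ; 0ℚ; 1ℚ; _+_; _*_; _÷_; _≤_; _<_; ≢-nonZero; _/_)
open import Data.Rational.Properties using (_≟_)
open import Data.Integer using (+_)
open import Data.Product using (Σ; _×_; _,_)
open import Relation.Nullary using (yes; no)
open import Relation.Binary.PropositionalEquality using (_≡_)

Σ[_] : ∀ n → (Fin n → ℚ) → ℚ
Σ[ zero ] f = 0ℚ
Σ[ suc n ] f = f fz + Σ[ n ] (λ i → f (fs i))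

-- Division returning 0 for a zero denominator (never triggered below,
-- since the total fitness F_S(X) ≥ n ≥ 1).
_÷?_ : ℚ → ℚ → ℚ
p ÷? q with q ≟ 0ℚ
... | yes _ = 0ℚ
... | no q≢0 = _÷_ p q {{≢-nonZero q≢0}}

Weights : ℕ → Set
Weights n = Fin n → Fin n → ℚ

data Reach {n : ℕ} (w : Weights n) (u : Fin n) : Fin n → Set where
  here : Reach w u u
  step : ∀ {v x} → Reach w u v → 0ℚ < w v x → Reach w u x

IsPopulationStructure : ∀ n → Weights n → Set
IsPopulationStructure n w =
  ((u v : Fin n) → 0ℚ ≤ w u v) ×
  ((u : Fin n) → Σ[ n ] (λ v → w u v) ≡ 1ℚ) ×
  ((u v : Fin n) → Reach w u v)

full? : ∀ {n} → Subset n → Bool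
full? [] = true
full? (b ∷ X) = b ∧ full? X

fitness : ∀ {n} → ℚ → Subset n → Subset n → Fin n → ℚ
fitness δ S X u = if lookup X u ∧ lookup S u then 1ℚ + δ else 1ℚ

totalFitness : ∀ {n} → ℚ → Subset n → Subset n → ℚ
totalFitness {n} δ S X = Σ[ n ] (fitness δ S X)

update : ∀ {n} → Subset n → Fin n → Fin n → Subset n
update X u v = X [ v ]≔ lookup X u

-- hit w δ S t X = P[ ∃ τ ≤ t . X_τ = V | X_0 = X ]  (first-step recursion).
hit : ∀ {n} → Weights n → ℚ → Subset n → ℕ → Subset n → ℚ
hit w δ S zero X = if full? X then 1ℚ else 0ℚ
hit {n} w δ S (suc t) X =
  if full? X then 1ℚ else
  Σ[ n ] (λ u → Σ[ n ] (λ v →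
    (fitness δ S X u ÷? totalFitness δ S X) * w u v * hit w δ S t (update X u v)))

-- (1/n) Σ_u P[ ∃ τ ≤ t . X_τ = V | X_0 = {u} ].
-- fp(G^S, δ) is the (monotone) limit of this as t → ∞.
fpUpTo : ∀ {n} → Weights n → ℚ → Subset n → ℕ → ℚ
fpUpTo {n} w δ S t =
  Σ[ n ] (λ u → hit w δ S t ⁅ u ⁆) ÷? ((+ n) / 1)

-- The set function S ↦ fp(G^S, δ) (given as the increasing sequence of
-- rational approximations fpUpTo) is NOT submodular: there are S, T with
-- fp(S) + fp(T) < fp(S ∪ T) + fp(S ∩ T).  With fp = sup_t fpUpTo t this
-- strict inequality of limits is equivalent to: ∃ ε > 0, ∃ t₀,
-- ∀ t, fpUpTo S t + fpUpTo T t + ε ≤ fpUpTo (S∪T) t₀ + fpUpTo (S∩T) t₀.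
NotSubmodularFp : ∀ {n} → Weights n → ℚ → Set
NotSubmodularFp {n} w δ =
  Σ (Subset n) λ S → Σ (Subset n) λ T → Σ ℚ λ ε → Σ ℕ λ t₀ →
    (0ℚ < ε) ×
    ((t : ℕ) → fpUpTo w δ S t + fpUpTo w δ T t + ε
               ≤ fpUpTo w δ (S ∪ T) t₀ + fpUpTo w δ (S ∩ T) t₀)

-- The example is the three-node graph W below with δ = 100, S = {0, 1} and T = {2}:
-- numerically fp(S) + fp(T) ≈ 0.604 + 0.590, whereas fp(S ∪ T) + fp(S ∩ T) = fp(V) + fp(∅)
-- ≈ 0.983 + 1/3.  To certify this with finite-horizon probabilities, note that hit t is
-- the t-th iterate, starting from the indicator of V, of the first-step operator,
-- which is monotone because all transition rates are nonnegative.  Hence any supersolution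
-- of the first-step equations (for instance the exact fixation probabilities) bounds hit t
-- from above for every t, while iterating and rounding down after each step bounds hit t₀
-- from below.

module Submission where

open import Defs
open import Data.Nat using (ℕ; zero; suc)
open import Data.Rational
  using (ℚ; NonZero; Positive; 0ℚ; 1ℚ; _≤_; _<_; _+_; _*_; _/_; _⊓_; 1/_; floor; ≢-nonZero; nonNegative)
open import Data.Rational.Properties
  using (_≟_; _≤?_; _<?_; ≤-refl; ≤-reflexive; ≤-trans; ≤ᵇ⇒≤; +-mono-≤; +-monoˡ-≤; *-monoʳ-≤-nonNeg; *-monoˡ-≤-nonNeg; p⊓q≤p;
         nonNegative⁻¹; normalize-nonNeg; nonNeg∧nonZero⇒pos; pos⇒nonZero; 1/pos⇒pos; pos⇒nonNeg;
         nonNeg*nonNeg⇒nonNeg; module ≤-Reasoning)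
open import Data.Integer using (+_)
open import Data.Product using (Σ; _×_; _,_)
open import Data.Unit using (tt)
open import Data.Bool using (true; false; if_then_else_; _∧_)
import Data.Vec as Vec
open import Data.Fin using (Fin)
open import Data.Fin.Patterns using (0F; 1F; 2F)
open import Data.Fin.Properties using (all?)
open import Data.Fin.Subset using (Subset; inside; outside; ⁅_⁆; _∪_; _∩_)
open import Data.Fin.Subset.Properties using (anySubset?)
open import Data.Vec using ([]; _∷_)
open import Function using (_∘_)
open import Relation.Nullary using (Dec; yes; no; ¬?)
open import Relation.Nullary.Decidable using (toWitness; decidable-stable; map′)
open import Relation.Unary using (Pred; Decidable)
open import Relation.Binary.PropositionalEquality using (_≡_; refl)

Σ[]-mono-≤ : ∀ n {f g : Fin n → ℚ} → (∀ i → f i ≤ g i) → Σ[ n ] f ≤ Σ[ n ] g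
Σ[]-mono-≤ zero    f≤g = ≤-refl
Σ[]-mono-≤ (suc n) f≤g = +-mono-≤ (f≤g 0F) (Σ[]-mono-≤ n (f≤g ∘ Fin.suc))

Σ[]-nonNeg : ∀ n {f : Fin n → ℚ} → (∀ i → 0ℚ ≤ f i) → 0ℚ ≤ Σ[ n ] f
Σ[]-nonNeg zero    0≤f = ≤-refl
Σ[]-nonNeg (suc n) 0≤f = +-mono-≤ (0≤f 0F) (Σ[]-nonNeg n (0≤f ∘ Fin.suc))

0≤1 : 0ℚ ≤ 1ℚ
0≤1 = nonNegative⁻¹ 1ℚ

*-nonNeg : ∀ {p q} → 0ℚ ≤ p → 0ℚ ≤ q → 0ℚ ≤ p * q
*-nonNeg {p} {q} 0≤p 0≤q =
  nonNegative⁻¹ (p * q) {{nonNeg*nonNeg⇒nonNeg p {{nonNegative 0≤p}} q {{nonNegative 0≤q}}}}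

1/-nonNeg : ∀ q .{{_ : NonZero q}} → 0ℚ ≤ q → 0ℚ ≤ 1/ q
1/-nonNeg q 0≤q = nonNegative⁻¹ q⁻¹ {{pos⇒nonNeg q⁻¹ {{1/pos⇒pos q {{q-positive}}}}}}
  where
  q-positive : Positive q
  q-positive = nonNeg∧nonZero⇒pos q {{nonNegative 0≤q}}

  q⁻¹ : ℚ
  q⁻¹ = (1/ q) {{pos⇒nonZero q {{q-positive}}}}

÷?-nonNeg : ∀ {p q} → 0ℚ ≤ p → 0ℚ ≤ q → 0ℚ ≤ p ÷? q
÷?-nonNeg {p} {q} 0≤p 0≤q with q ≟ 0ℚ
... | yes _   = ≤-refl
... | no q≢0 = *-nonNeg 0≤p (1/-nonNeg q 0≤q)
  where instance _ = ≢-nonZero q≢0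

÷?-monoˡ-≤ : ∀ {p p′ q} → 0ℚ ≤ q → p ≤ p′ → p ÷? q ≤ p′ ÷? q
÷?-monoˡ-≤ {q = q} 0≤q p≤p′ with q ≟ 0ℚ
... | yes _   = ≤-refl
... | no q≢0 = *-monoʳ-≤-nonNeg _ {{nonNegative (1/-nonNeg q 0≤q)}} p≤p′
  where instance _ = ≢-nonZero q≢0

-- fpUpTo w δ S t is definitionally average (λ u → hit w δ S t ⁅ u ⁆).
average : ∀ {n} → (Fin n → ℚ) → ℚ
average {n} a = Σ[ n ] a ÷? (+ n / 1)

average-mono-≤ : ∀ {n} {a b : Fin n → ℚ} → (∀ i → a i ≤ b i) → average a ≤ average b
average-mono-≤ {n} a≤b =
  ÷?-monoˡ-≤ (nonNegative⁻¹ (+ n / 1) {{normalize-nonNeg n 1}}) (Σ[]-mono-≤ n a≤b)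

allSubset? : ∀ {n ℓ} {P : Pred (Subset n) ℓ} → Decidable P → Dec (∀ X → P X)
allSubset? P? = map′ (λ ¬∃¬P X → decidable-stable (P? X) (¬∃¬P ∘ (X ,_)))
                     (λ ∀P (X , ¬PX) → ¬PX (∀P X))
                     (¬? (anySubset? (¬? ∘ P?)))

Table : ℕ → Set
Table zero    = ℚ
Table (suc n) = Table n × Table n

tabulate : ∀ {n} → (Subset n → ℚ) → Table n
tabulate {zero}  f = f []
tabulate {suc n} f = tabulate (f ∘ (inside ∷_)) , tabulate (f ∘ (outside ∷_))

lookup : ∀ {n} → Table n → Subset n → ℚ
lookup q       []            = q
lookup (t , _) (inside  ∷ X) = lookup t X
lookup (_ , t) (outside ∷ X) = lookup t X

lookup-tabulate : ∀ {n} (f : Subset n → ℚ) X → lookup (tabulate f) X ≡ f X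
lookup-tabulate f []            = refl
lookup-tabulate f (inside  ∷ X) = lookup-tabulate (f ∘ (inside ∷_)) X
lookup-tabulate f (outside ∷ X) = lookup-tabulate (f ∘ (outside ∷_)) X

-- Since floor (1000 q) / 1000 ≤ q, the minimum is always the rounded value; taking it yields
-- roundDown-≤ without a lemma about floor.  Rounding keeps the denominators of the iterates small.
roundDown : ℚ → ℚ
roundDown q = q ⊓ (floor (q * (+ 1000 / 1)) / 1000)

roundDown-≤ : ∀ q → roundDown q ≤ q
roundDown-≤ q = p⊓q≤p q _

module FirstStep {n} (w : Weights n) (w-nonNeg : ∀ u v → 0ℚ ≤ w u v)
                 (δ : ℚ) (δ-nonNeg : 0ℚ ≤ δ) (S : Subset n) where

  rate : Subset n → Fin n → Fin n → ℚ
  rate X u v = (fitness δ S X u ÷? totalFitness δ S X) * w u v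

  fixated : Subset n → ℚ
  fixated X = if full? X then 1ℚ else 0ℚ

  -- hit w δ S (suc t) X reduces to firstStep (hit w δ S t) X.
  firstStep : (Subset n → ℚ) → Subset n → ℚ
  firstStep g X =
    if full? X then 1ℚ else Σ[ n ] (λ u → Σ[ n ] (λ v → rate X u v * g (update X u v)))

  fitness-nonNeg : ∀ X u → 0ℚ ≤ fitness δ S X u
  fitness-nonNeg X u with Vec.lookup X u ∧ Vec.lookup S u
  ... | true  = +-mono-≤ 0≤1 δ-nonNeg
  ... | false = 0≤1

  rate-nonNeg : ∀ X u v → 0ℚ ≤ rate X u v
  rate-nonNeg X u v =
    *-nonNeg (÷?-nonNeg (fitness-nonNeg X u) (Σ[]-nonNeg n (fitness-nonNeg X))) (w-nonNeg u v)

  firstStep-mono-≤ : ∀ {g h} → (∀ X → g X ≤ h X) → ∀ X → firstStep g X ≤ firstStep h X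
  firstStep-mono-≤ g≤h X with full? X
  ... | true  = ≤-refl
  ... | false = Σ[]-mono-≤ n λ u → Σ[]-mono-≤ n λ v →
                  *-monoˡ-≤-nonNeg (rate X u v) {{nonNegative (rate-nonNeg X u v)}} (g≤h (update X u v))

  IsSupersolution : (Subset n → ℚ) → Set
  IsSupersolution h = (∀ X → fixated X ≤ h X) × (∀ X → firstStep h X ≤ h X)

  hit-≤-supersolution : ∀ {h} → IsSupersolution h → ∀ t X → hit w δ S t X ≤ h X
  hit-≤-supersolution (fixated≤h , _)      zero    X = fixated≤h X
  hit-≤-supersolution sup@(_ , step≤h) (suc t) X =
    ≤-trans (firstStep-mono-≤ (hit-≤-supersolution sup t) X) (step≤h X)

  -- Tabulating every iterate lets evaluation share it, so that computing lowerTable t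
  -- takes time linear rather than exponential in t.
  improve : Table n → Table n
  improve g = tabulate (roundDown ∘ firstStep (lookup g))

  lowerTable : ℕ → Table n
  lowerTable zero    = tabulate fixated
  lowerTable (suc t) = improve (lowerTable t)

  lowerTable-≤-hit : ∀ t X → lookup (lowerTable t) X ≤ hit w δ S t X
  lowerTable-≤-hit zero    X = ≤-reflexive (lookup-tabulate fixated X)
  lowerTable-≤-hit (suc t) X = begin
    lookup (improve (lowerTable t)) X                ≡⟨ lookup-tabulate _ X ⟩
    roundDown (firstStep (lookup (lowerTable t)) X)  ≤⟨ roundDown-≤ _ ⟩
    firstStep (lookup (lowerTable t)) X              ≤⟨ firstStep-mono-≤ (lowerTable-≤-hit t) X ⟩
    hit w δ S (suc t) X                              ∎
    where open ≤-Reasoning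

  fpUpTo-≤-supersolution : ∀ {h} → IsSupersolution h → ∀ t → fpUpTo w δ S t ≤ average (h ∘ ⁅_⁆)
  fpUpTo-≤-supersolution sup t = average-mono-≤ (λ u → hit-≤-supersolution sup t ⁅ u ⁆)

  -- Opaque so that the type checker runs the t-step computation only where
  -- 5/4-≤-lowerSum unfolds it, never while unifying.
  opaque
    fpLowerBound : ℕ → ℚ
    fpLowerBound t = average (λ u → lookup (lowerTable t) ⁅ u ⁆)

    fpLowerBound-≤-fpUpTo : ∀ t → fpLowerBound t ≤ fpUpTo w δ S t
    fpLowerBound-≤-fpUpTo t = average-mono-≤ (λ u → lowerTable-≤-hit t ⁅ u ⁆)

notSubmodularFp-from-bounds :
  ∀ {n} (w : Weights n) (δ : ℚ) (S T : Subset n) (t₀ : ℕ) {a b c d ε : ℚ} → 0ℚ < ε →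
  (∀ t → fpUpTo w δ S t ≤ a) → (∀ t → fpUpTo w δ T t ≤ b) →
  c ≤ fpUpTo w δ (S ∪ T) t₀ → d ≤ fpUpTo w δ (S ∩ T) t₀ →
  a + b + ε ≤ c + d → NotSubmodularFp w δ
notSubmodularFp-from-bounds w δ S T t₀ {a} {b} {c} {d} {ε} 0<ε S≤a T≤b c≤S∪T d≤S∩T gap =
  S , T , ε , t₀ , 0<ε , λ t → begin
    fpUpTo w δ S t + fpUpTo w δ T t + ε            ≤⟨ +-monoˡ-≤ ε (+-mono-≤ (S≤a t) (T≤b t)) ⟩
    a + b + ε                                      ≤⟨ gap ⟩
    c + d                                          ≤⟨ +-mono-≤ c≤S∪T d≤S∩T ⟩
    fpUpTo w δ (S ∪ T) t₀ + fpUpTo w δ (S ∩ T) t₀ ∎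
  where open ≤-Reasoning

W : Weights 3
W 0F 0F = 0ℚ
W 0F 1F = + 3 / 4
W 0F 2F = + 1 / 4
W 1F 0F = 0ℚ
W 1F 1F = + 3 / 4
W 1F 2F = + 1 / 4
W 2F 0F = + 1 / 4
W 2F 1F = 0ℚ
W 2F 2F = + 3 / 4

W-nonNeg : ∀ u v → 0ℚ ≤ W u v
W-nonNeg = toWitness {a? = all? λ u → all? λ v → 0ℚ ≤? W u v} tt

W-rowSum : ∀ u → Σ[ 3 ] (W u) ≡ 1ℚ
W-rowSum 0F = refl
W-rowSum 1F = refl
W-rowSum 2F = refl

0↦1 : 0ℚ < W 0F 1F
0↦1 = toWitness {a? = 0ℚ <? W 0F 1F} tt

1↦2 : 0ℚ < W 1F 2F
1↦2 = toWitness {a? = 0ℚ <? W 1F 2F} tt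

2↦0 : 0ℚ < W 2F 0F
2↦0 = toWitness {a? = 0ℚ <? W 2F 0F} tt

W-stronglyConnected : ∀ u v → Reach W u v
W-stronglyConnected 0F 0F = here
W-stronglyConnected 0F 1F = step here 0↦1
W-stronglyConnected 0F 2F = step {v = 1F} (step here 0↦1) 1↦2
W-stronglyConnected 1F 0F = step {v = 2F} (step here 1↦2) 2↦0
W-stronglyConnected 1F 1F = here
W-stronglyConnected 1F 2F = step here 1↦2
W-stronglyConnected 2F 0F = step here 2↦0
W-stronglyConnected 2F 1F = step {v = 0F} (step here 2↦0) 0↦1
W-stronglyConnected 2F 2F = here

W-isPopulationStructure : IsPopulationStructure 3 W
W-isPopulationStructure = W-nonNeg , W-rowSum , W-stronglyConnected

δ₀ : ℚ
δ₀ = + 100 / 1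

δ₀-nonNeg : 0ℚ ≤ δ₀
δ₀-nonNeg = nonNegative⁻¹ δ₀

S₀ T₀ : Subset 3
S₀ = inside  ∷ inside  ∷ outside ∷ []
T₀ = outside ∷ outside ∷ inside  ∷ []

module ProcessS = FirstStep W W-nonNeg δ₀ δ₀-nonNeg S₀
module ProcessT = FirstStep W W-nonNeg δ₀ δ₀-nonNeg T₀
module Process∪ = FirstStep W W-nonNeg δ₀ δ₀-nonNeg (S₀ ∪ T₀)
module Process∩ = FirstStep W W-nonNeg δ₀ δ₀-nonNeg (S₀ ∩ T₀)

-- The exact fixation probabilities, i.e. the solutions of the first-step equations
-- h = firstStep h with h = 0 at the empty set.
fixationS₀ : Subset 3 → ℚ
fixationS₀ (outside ∷ outside ∷ outside ∷ []) = 0ℚ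
fixationS₀ (inside  ∷ outside ∷ outside ∷ []) = + 162777357 / 163493695
fixationS₀ (outside ∷ inside  ∷ outside ∷ []) = + 630558251 / 1307949560
fixationS₀ (inside  ∷ inside  ∷ outside ∷ []) = + 1304612657 / 1307949560
fixationS₀ (outside ∷ outside ∷ inside  ∷ []) = + 435976903 / 1307949560
fixationS₀ (inside  ∷ outside ∷ inside  ∷ []) = + 1307930709 / 1307949560
fixationS₀ (outside ∷ inside  ∷ inside  ∷ []) = + 81160963 / 163493695
fixationS₀ (inside  ∷ inside  ∷ inside  ∷ []) = 1ℚ

fixationT₀ : Subset 3 → ℚ
fixationT₀ (outside ∷ outside ∷ outside ∷ []) = 0ℚ
fixationT₀ (inside  ∷ outside ∷ outside ∷ []) = + 16164 / 25615
fixationT₀ (outside ∷ inside  ∷ outside ∷ []) = + 25351 / 102460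
fixationT₀ (inside  ∷ inside  ∷ outside ∷ []) = + 76757 / 102460
fixationT₀ (outside ∷ outside ∷ inside  ∷ []) = + 91203 / 102460
fixationT₀ (inside  ∷ outside ∷ inside  ∷ []) = + 93009 / 102460
fixationT₀ (outside ∷ inside  ∷ inside  ∷ []) = + 25351 / 25615
fixationT₀ (inside  ∷ inside  ∷ inside  ∷ []) = 1ℚ

fixationS₀-isSupersolution : ProcessS.IsSupersolution fixationS₀
fixationS₀-isSupersolution =
  toWitness {a? = allSubset? λ X → ProcessS.fixated X ≤? fixationS₀ X} tt ,
  toWitness {a? = allSubset? λ X → ProcessS.firstStep fixationS₀ X ≤? fixationS₀ X} tt

fixationT₀-isSupersolution : ProcessT.IsSupersolution fixationT₀
fixationT₀-isSupersolution =
  toWitness {a? = allSubset? λ X → ProcessT.fixated X ≤? fixationT₀ X} tt ,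
  toWitness {a? = allSubset? λ X → ProcessT.firstStep fixationT₀ X ≤? fixationT₀ X} tt

t₀ : ℕ
t₀ = 25

ε : ℚ
ε = + 1 / 20

ε-positive : 0ℚ < ε
ε-positive = toWitness {a? = 0ℚ <? ε} tt

-- 5/4 separates fp(S₀) + fp(T₀) + ε ≈ 1.243 from the lower bound ≈ 1.283 reached after t₀ steps.
upperSum+ε-≤-5/4 : average (fixationS₀ ∘ ⁅_⁆) + average (fixationT₀ ∘ ⁅_⁆) + ε ≤ + 5 / 4
upperSum+ε-≤-5/4 = ≤ᵇ⇒≤ tt

opaque
  unfolding FirstStep.fpLowerBound

  5/4-≤-lowerSum : + 5 / 4 ≤ Process∪.fpLowerBound t₀ + Process∩.fpLowerBound t₀
  5/4-≤-lowerSum = ≤ᵇ⇒≤ tt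

theorem2 : Σ ℕ λ m → Σ (Weights (suc m)) λ w → Σ ℚ λ δ →
    IsPopulationStructure (suc m) w × (0ℚ ≤ δ) × NotSubmodularFp w δ
theorem2 = 2 , W , δ₀ , W-isPopulationStructure , δ₀-nonNeg ,
  notSubmodularFp-from-bounds W δ₀ S₀ T₀ t₀ ε-positive
    (ProcessS.fpUpTo-≤-supersolution fixationS₀-isSupersolution)
    (ProcessT.fpUpTo-≤-supersolution fixationT₀-isSupersolution)
    (Process∪.fpLowerBound-≤-fpUpTo t₀)
    (Process∩.fpLowerBound-≤-fpUpTo t₀)
    (≤-trans upperSum+ε-≤-5/4 5/4-≤-lowerSum)
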